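{- Let $\mathcal{P}_4$ be the set of partitions $\lambda=(\lambda_1>\lambda_2>\cdots>\lambda_\ell)$ into distinct positive parts such that for each $1\le i<\ell$: $\lambda_i-\lambda_{i+1}\equiv2\pmod 4$ if $\lambda_i,\lambda_{i+1}$ are both odd; $\lambda_i-\lambda_{i+1}\equiv0\pmod 4$ if they are both even; $\lambda_i-\lambda_{i+1}\equiv3\pmod 4$ if they have different parity; and the smallest part satisfies $\lambda_\ell\equiv1$ or $2\pmod 4$ (the empty partition is included). Let $\mathcal{P}_{4,e}$ and $\mathcal{P}_{4,o}$ be the subsets of $\mathcal{P}_4$ of partitions with an even and odd number of parts, respectively. Then $$\sum_{\lambda\in\mathcal{P}_{4,e}}x^{o(\lambda)}y^{e(\lambda)}q^{|\lambda|}=\sum_{n=0}^{\infty}\frac{(-yq/x;q^2)_{2n}x^{2n}q^{4n^2}}{(q^4;q^4)_{2n}},$$ $$\sum_{\lambda\in\mathcal{P}_{4,o}}x^{o(\lambda)}y^{e(\lambda)}q^{|\lambda|}=\sum_{n=0}^{\infty}\frac{(-yq/x;q^2)_{2n+1}x^{2n+1}q^{4n^2+4n+1}}{(q^4;q^4)_{2n+1}},$$ $$\sum_{\lambda\in\mathcal{P}_4}x^{o(\lambda)}y^{e(\lambda)}q^{|\lambda|}=\sum_{n=0}^{\infty}\frac{(-yq/x;q^2)_{n}x^{n}q^{n^2}}{(q^4;q^4)_{n}}.$$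
   Context: $o(\lambda)$ and $e(\lambda)$ are the numbers of odd and even parts of $\lambda$, $|\lambda|$ is the sum of parts, $(a;q)_n=\prod_{i=0}^{n-1}(1-aq^i)$, and $|q|<1$ (or identities of formal power series). -}

module Defs where

open import Data.Nat using (ℕ; zero; suc; _+_; _*_; _∸_; _<_; _%_; _≡ᵇ_)
open import Data.Bool using (Bool; true; false; _∧_; if_then_else_)
open import Data.List using (List; []; _∷_; length)
open import Data.Product using (_×_; Σ)
open import Data.Sum using (_⊎_)
open import Relation.Binary.PropositionalEquality using (_≡_)

-- A partition is written as a list of parts in decreasing order.

isOdd : ℕ → Bool
isOdd n = (n % 2) ≡ᵇ 1

size : List ℕ → ℕ
size []      = 0
size (p ∷ l) = p + size l

oddParts : List ℕ → ℕ
oddParts []      = 0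
oddParts (p ∷ l) = (if isOdd p then 1 else 0) + oddParts l

evenParts : List ℕ → ℕ
evenParts []      = 0
evenParts (p ∷ l) = (if isOdd p then 0 else 1) + evenParts l

-- required residue mod 4 of λᵢ - λᵢ₊₁ according to the parities
requiredGap : Bool → Bool → ℕ
requiredGap true  true  = 2
requiredGap false false = 0
requiredGap true  false = 3
requiredGap false true  = 3

-- membership in P₄ (the parts are strictly decreasing; the last part is
-- ≡ 1 or 2 mod 4, hence all parts are positive)
data P4 : List ℕ → Set where
  p4-nil  : P4 []
  p4-last : ∀ {a} → (a % 4 ≡ 1 ⊎ a % 4 ≡ 2) → P4 (a ∷ [])
  p4-cons : ∀ {a b l} → b < a →
            (a ∸ b) % 4 ≡ requiredGap (isOdd a) (isOdd b) →
            P4 (b ∷ l) → P4 (a ∷ b ∷ l)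

-- f n a b = coefficient of qⁿ xᵃ yᵇ
Series : Set
Series = ℕ → ℕ → ℕ → ℕ

∑< : ℕ → (ℕ → ℕ) → ℕ
∑< zero    f = 0
∑< (suc n) f = ∑< n f + f n

_⊕_ : Series → Series → Series
(f ⊕ g) n a b = f n a b + g n a b

_⊛_ : Series → Series → Series
(f ⊛ g) n a b =
  ∑< (suc n) λ i → ∑< (suc a) λ j → ∑< (suc b) λ k →
    f i j k * g (n ∸ i) (a ∸ j) (b ∸ k)

mono : ℕ → ℕ → ℕ → Series
mono n a b n' a' b' = if (n ≡ᵇ n') ∧ (a ≡ᵇ a') ∧ (b ≡ᵇ b') then 1 else 0

one : Series
one = mono 0 0 0

-- 1/(1 - q^(4(i+1))) = ∑ₖ q^(4(i+1)k)
geomInv4 : ℕ → Series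
geomInv4 i n a b =
  if (a ≡ᵇ 0) ∧ (b ≡ᵇ 0) ∧ ((n % (4 * suc i)) ≡ᵇ 0) then 1 else 0

-- (-yq/x ; q²)ₙ xⁿ = ∏_{i<n} (x + y q^(2i+1))
pochNum : ℕ → Series
pochNum zero    = one
pochNum (suc n) = pochNum n ⊛ (mono 0 1 0 ⊕ mono (2 * n + 1) 0 1)

-- 1/(q⁴;q⁴)ₙ = ∏_{i<n} 1/(1 - q^(4(i+1)))
pochDenInv : ℕ → Series
pochDenInv zero    = one
pochDenInv (suc n) = pochDenInv n ⊛ geomInv4 n

-- n-th summand:  (-yq/x;q²)ₙ xⁿ q^(n²) / (q⁴;q⁴)ₙ
term : ℕ → Series
term n = (pochNum n ⊛ mono (n * n) 0 0) ⊛ pochDenInv n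

-- ∑_{n ≥ 0} t n as a formal power series, valid when t n has q-order
-- ≥ n (true for all sums below since the q-order of term m is m²):
-- the coefficient of q^N only receives contributions from n ≤ N.
∑series : (ℕ → Series) → Series
∑series t N a b = ∑< (suc N) λ n → t n N a b

rhsEven rhsOdd rhsAll : Series
rhsEven = ∑series λ n → term (2 * n)          -- q^(4n²) = q^((2n)²)
rhsOdd  = ∑series λ n → term (2 * n + 1)      -- q^(4n²+4n+1) = q^((2n+1)²)
rhsAll  = ∑series term

P4with : (ℕ → Set) → ℕ → ℕ → ℕ → Set
P4with parity N a b =
  Σ (List ℕ) λ l → P4 l × parity (length l) × size l ≡ N × oddParts l ≡ a × evenParts l ≡ b

module Submission where

open import Defs
open import Data.Nat using (ℕ; _%_)
open import Data.Fin using (Fin)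
open import Data.Unit using (⊤)
open import Data.Product using (_×_)
open import Function.Bundles using (_↔_)
open import Relation.Binary.PropositionalEquality using (_≡_)

open import Data.Nat using (zero; suc; _+_; _*_; _∸_; _<_; _≤_; _/_; _≟_; _≡ᵇ_; z≤n; s≤s)
open import Data.Nat.Properties
open import Data.Nat.DivMod using (m≡m%n+[m/n]*n; [m+kn]%n≡m%n; m*n%n≡0; m*[n/m]≡n)
open import Data.Nat.Divisibility using (m%n≡0⇒n∣m)
open import Data.Nat.Tactic.RingSolver using (solve-∀)
open import Data.Fin using (zero)
open import Data.Fin.Properties using (+↔⊎; *↔×)
open import Data.Unit using (tt)
open import Data.Empty using (⊥-elim)
open import Data.Bool using (true; false; T; _∧_; if_then_else_)
open import Data.Bool.Properties using (T-∧)
open import Data.Product using (Σ; ∃; ∃₂; _,_; proj₁)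
open import Data.Sum using (_⊎_; inj₁; inj₂; [_,_]′)
open import Data.List using (List; []; _∷_; [_]; length; map; _++_; _∷ʳ_; initLast; _∷ʳ′_)
open import Data.List.Properties using (length-++; length-map; map-injective; ∷ʳ-injective)
open import Function.Base using (const; _∘_)
open import Function.Bundles using (Inverse; Equivalence; _⇔_; mk⇔; mk↔ₛ′; mk⤖)
open import Function.Definitions using (Bijective)
open import Function.Consequences.Propositional using (strictlySurjective⇒surjective)
open import Function.Properties.Inverse using (↔-trans; ↔-sym; ↔-refl)
open import Function.Properties.Bijection using (⤖⇒↔)
open import Function.Related.TypeIsomorphisms using (Σ-distribʳ-⊎)
open import Data.Product.Function.Dependent.Propositional using (Σ-↔)
open import Data.Product.Function.NonDependent.Propositional using (_×-↔_)
open import Data.Sum.Function.Propositional using (_⊎-↔_)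
open import Relation.Binary.PropositionalEquality
  using (_≢_; refl; sym; trans; cong; cong₂; subst; subst₂; module ≡-Reasoning)
open import Relation.Nullary using (¬_; yes; no)
open import Relation.Nullary.Irrelevant using (Irrelevant)
open import Relation.Unary using (Decidable)

open Inverse using (to)

-- The n-th summand counts the partitions in P₄ with exactly n parts.  Such a
-- partition arises uniquely from one with n − 1 parts by appending a new
-- smallest part 4m + r (r = 1 or 2) and adding (4m + r) + r to every old part:
-- the old smallest part is ≡ 1 or 2 mod 4, and adding r to it produces exactly
-- the gap class prescribed by the parities.  This step has weight
-- x q^(2n−1+4mn) for r = 1 and y q^(2(2n−1)+4mn) for r = 2, which accounts for
-- q^(n²) ∏_{i<n} (x + y q^(2i+1)) / (1 − q^(4(i+1))).  A partition with a odd
-- and b even parts has a + b parts and weight at least a + b, so only the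
-- summand n = a + b contributes to the coefficient of q^N x^a y^b.

irrelevant-↔ : {A B : Set} → Irrelevant A → Irrelevant B → A ⇔ B → A ↔ B
irrelevant-↔ irrA irrB e =
  mk↔ₛ′ (Equivalence.to e) (Equivalence.from e) (λ _ → irrB _ _) (λ _ → irrA _ _)

indicator-↔ : ∀ c {A : Set} → Irrelevant A → T c ⇔ A → Fin (if c then 1 else 0) ↔ A
indicator-↔ true  irr e =
  mk↔ₛ′ (λ _ → Equivalence.to e tt) (λ _ → zero) (λ _ → irr _ _) (λ { zero → refl })
indicator-↔ false irr e =
  mk↔ₛ′ (λ ()) (λ x → ⊥-elim (Equivalence.from e x)) (λ x → ⊥-elim (Equivalence.from e x)) (λ ())

empty-↔ : ∀ {k} {A : Set} → k ≡ 0 → ¬ A → Fin k ↔ A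
empty-↔ refl ¬A = mk↔ₛ′ (λ ()) (⊥-elim ∘ ¬A) (⊥-elim ∘ ¬A) (λ ())

Σ< : ℕ → (ℕ → Set) → Set
Σ< n A = Σ ℕ λ i → i < n × A i

Σ<-cong : ∀ {n} {A B : ℕ → Set} → (∀ i → A i ↔ B i) → Σ< n A ↔ Σ< n B
Σ<-cong e = Σ-↔ ↔-refl (λ {i} → ↔-refl ×-↔ e i)

Σ<-suc : ∀ n (A : ℕ → Set) → (Σ< n A ⊎ A n) ↔ Σ< (suc n) A
Σ<-suc n A = mk↔ₛ′ extend restrict extend-restrict restrict-extend
  where
  extend : Σ< n A ⊎ A n → Σ< (suc n) A
  extend (inj₁ (i , i<n , x)) = i , m<n⇒m<1+n i<n , x
  extend (inj₂ x)             = n , n<1+n n , x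
  restrict : Σ< (suc n) A → Σ< n A ⊎ A n
  restrict (i , i<1+n , x) with i ≟ n
  ... | yes refl = inj₂ x
  ... | no  i≢n  = inj₁ (i , ≤∧≢⇒< (≤-pred i<1+n) i≢n , x)
  extend-restrict : ∀ y → extend (restrict y) ≡ y
  extend-restrict (i , i<1+n , x) with i ≟ n
  ... | yes refl = cong (λ p → n , p , x) (<-irrelevant _ _)
  ... | no  _    = cong (λ p → i , p , x) (<-irrelevant _ _)
  restrict-extend : ∀ y → restrict (extend y) ≡ y
  restrict-extend (inj₁ (i , i<n , x)) with i ≟ n
  ... | yes refl = ⊥-elim (<-irrefl refl i<n)
  ... | no  _    = cong (λ p → inj₁ (i , p , x)) (<-irrelevant _ _)
  restrict-extend (inj₂ x) with n ≟ n
  ... | yes refl = refl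
  ... | no  n≢n  = ⊥-elim (n≢n refl)

∑<-↔ : ∀ n (h : ℕ → ℕ) → Fin (∑< n h) ↔ Σ< n (Fin ∘ h)
∑<-↔ zero    h = mk↔ₛ′ (λ ()) (λ { (_ , () , _) }) (λ { (_ , () , _) }) (λ ())
∑<-↔ (suc n) h = ↔-trans +↔⊎ (↔-trans (∑<-↔ n h ⊎-↔ ↔-refl) (Σ<-suc n _))

∑<-vanishes : ∀ K (f : ℕ → ℕ) → (∀ n → n < K → f n ≡ 0) → ∑< K f ≡ 0
∑<-vanishes zero    f _ = refl
∑<-vanishes (suc K) f h = cong₂ _+_ (∑<-vanishes K f (λ n → h n ∘ m<n⇒m<1+n)) (h K (n<1+n K))

∑<-single : ∀ K k (f : ℕ → ℕ) → (∀ n → n ≢ k → f n ≡ 0) → (K ≤ k → f k ≡ 0) → ∑< K f ≡ f k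
∑<-single zero    k f _     above = sym (above z≤n)
∑<-single (suc K) k f off above with K ≟ k
... | yes refl = cong (_+ f K) (∑<-vanishes K f (λ n n<K → off n (λ { refl → <-irrefl refl n<K })))
... | no  K≢k  =
  trans (cong₂ _+_ (∑<-single K k f off (λ K≤k → above (≤∧≢⇒< K≤k K≢k))) (off K K≢k)) (+-identityʳ _)

×≡-irrelevant : ∀ {k l m n o p : ℕ} → Irrelevant (k ≡ l × m ≡ n × o ≡ p)
×≡-irrelevant (p , q , r) (p′ , q′ , r′) =
  cong₂ _,_ (≡-irrelevant p p′) (cong₂ _,_ (≡-irrelevant q q′) (≡-irrelevant r r′))

record Weighted : Set₁ where
  constructor weighted
  field
    Carrier        : Set
    qDeg xDeg yDeg : Carrier → ℕ

open Weighted

Fibre : Weighted → ℕ → ℕ → ℕ → Set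
Fibre W N a b = Σ (Carrier W) λ w → qDeg W w ≡ N × xDeg W w ≡ a × yDeg W w ≡ b

fibre-≡ : ∀ {W N a b} {u v : Fibre W N a b} → proj₁ u ≡ proj₁ v → u ≡ v
fibre-≡ {u = w , _} {.w , _} refl = cong (w ,_) (×≡-irrelevant _ _)

fibre-↔ : ∀ {V W} (e : Carrier V ↔ Carrier W) →
          (∀ v → qDeg W (to e v) ≡ qDeg V v) →
          (∀ v → xDeg W (to e v) ≡ xDeg V v) →
          (∀ v → yDeg W (to e v) ≡ yDeg V v) →
          ∀ {N a b} → Fibre V N a b ↔ Fibre W N a b
fibre-↔ e q x y = Σ-↔ e (λ {v} → irrelevant-↔ ×≡-irrelevant ×≡-irrelevant (mk⇔
  (λ (p , r , s) → trans (q v) p , trans (x v) r , trans (y v) s)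
  (λ (p , r , s) → trans (sym (q v)) p , trans (sym (x v)) r , trans (sym (y v)) s)))

_Enumerates_ : Series → Weighted → Set
f Enumerates W = ∀ N a b → Fin (f N a b) ↔ Fibre W N a b

point : ℕ → ℕ → ℕ → Weighted
point n a b = weighted ⊤ (const n) (const a) (const b)

multiplesOf : ℕ → Weighted
multiplesOf d = weighted ℕ (_* d) (const 0) (const 0)

_⊎ʷ_ : Weighted → Weighted → Weighted
V ⊎ʷ W = weighted (Carrier V ⊎ Carrier W)
  [ qDeg V , qDeg W ]′ [ xDeg V , xDeg W ]′ [ yDeg V , yDeg W ]′

_×ʷ_ : Weighted → Weighted → Weighted
V ×ʷ W = weighted (Carrier V × Carrier W)
  (λ (v , w) → qDeg V v + qDeg W w)
  (λ (v , w) → xDeg V v + xDeg W w)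
  (λ (v , w) → yDeg V v + yDeg W w)

mono-enumerates : ∀ n a b → mono n a b Enumerates point n a b
mono-enumerates n a b N a′ b′ =
  indicator-↔ ((n ≡ᵇ N) ∧ (a ≡ᵇ a′) ∧ (b ≡ᵇ b′)) irrelevant (mk⇔ fibre unfibre)
  where
  irrelevant : Irrelevant (Fibre (point n a b) N a′ b′)
  irrelevant (tt , u) (tt , v) = cong (tt ,_) (×≡-irrelevant u v)
  fibre : T ((n ≡ᵇ N) ∧ (a ≡ᵇ a′) ∧ (b ≡ᵇ b′)) → Fibre (point n a b) N a′ b′
  fibre t with Equivalence.to T-∧ t
  ... | tn , tab with Equivalence.to T-∧ tab
  ... | ta , tb = tt , ≡ᵇ⇒≡ n N tn , ≡ᵇ⇒≡ a a′ ta , ≡ᵇ⇒≡ b b′ tb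
  unfibre : Fibre (point n a b) N a′ b′ → T ((n ≡ᵇ N) ∧ (a ≡ᵇ a′) ∧ (b ≡ᵇ b′))
  unfibre (tt , p , q , r) = Equivalence.from T-∧
    (≡⇒≡ᵇ n N p , Equivalence.from T-∧ (≡⇒≡ᵇ a a′ q , ≡⇒≡ᵇ b b′ r))

geomInv4-enumerates : ∀ i → geomInv4 i Enumerates multiplesOf (4 * suc i)
geomInv4-enumerates i N a b =
  indicator-↔ ((a ≡ᵇ 0) ∧ (b ≡ᵇ 0) ∧ ((N % d) ≡ᵇ 0)) irrelevant (mk⇔ fibre unfibre)
  where
  d = 4 * suc i
  irrelevant : Irrelevant (Fibre (multiplesOf d) N a b)
  irrelevant (m , u) (m′ , v) with *-cancelʳ-≡ m m′ d (trans (proj₁ u) (sym (proj₁ v)))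
  ... | refl = cong (m ,_) (×≡-irrelevant u v)
  fibre : T ((a ≡ᵇ 0) ∧ (b ≡ᵇ 0) ∧ ((N % d) ≡ᵇ 0)) → Fibre (multiplesOf d) N a b
  fibre t with Equivalence.to T-∧ t
  ... | ta , tbN with Equivalence.to T-∧ tbN
  ... | tb , tN = N / d , sym (trans (m≡m%n+[m/n]*n N d) (cong (_+ N / d * d) (≡ᵇ⇒≡ _ 0 tN))) ,
                  sym (≡ᵇ⇒≡ a 0 ta) , sym (≡ᵇ⇒≡ b 0 tb)
  unfibre : Fibre (multiplesOf d) N a b → T ((a ≡ᵇ 0) ∧ (b ≡ᵇ 0) ∧ ((N % d) ≡ᵇ 0))
  unfibre (m , refl , refl , refl) = Equivalence.from T-∧
    (tt , Equivalence.from T-∧ (tt , ≡⇒≡ᵇ _ 0 (m*n%n≡0 m d)))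

⊕-enumerates : ∀ {f g V W} → f Enumerates V → g Enumerates W → (f ⊕ g) Enumerates (V ⊎ʷ W)
⊕-enumerates ef eg N a b = ↔-trans +↔⊎ (↔-trans (ef N a b ⊎-↔ eg N a b) (↔-sym Σ-distribʳ-⊎))

module _ (V W : Weighted) (N a b : ℕ) where

  Splittings : Set
  Splittings = Σ< (suc N) λ i → Σ< (suc a) λ j → Σ< (suc b) λ k →
                 Fibre V i j k × Fibre W (N ∸ i) (a ∸ j) (b ∸ k)

  private
    +≡⇒<suc : ∀ {m n s} → m + n ≡ s → m < suc s
    +≡⇒<suc {m} {n} refl = s≤s (m≤m+n m n)

    +≡⇒≡∸ : ∀ {m n s} → m + n ≡ s → n ≡ s ∸ m
    +≡⇒≡∸ {m} {n} refl = sym (m+n∸m≡n m n)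

    ≡∸⇒+≡ : ∀ {m n s} → m < suc s → n ≡ s ∸ m → m + n ≡ s
    ≡∸⇒+≡ m<1+s refl = m+[n∸m]≡n (≤-pred m<1+s)

    join : Splittings → Fibre (V ×ʷ W) N a b
    join (_ , i< , _ , j< , _ , k< , (v , refl , refl , refl) , (w , p , q , r)) =
      (v , w) , ≡∸⇒+≡ i< p , ≡∸⇒+≡ j< q , ≡∸⇒+≡ k< r

    split : Fibre (V ×ʷ W) N a b → Splittings
    split ((v , w) , p , q , r) =
      qDeg V v , +≡⇒<suc p , xDeg V v , +≡⇒<suc q , yDeg V v , +≡⇒<suc r ,
      (v , refl , refl , refl) , (w , +≡⇒≡∸ p , +≡⇒≡∸ q , +≡⇒≡∸ r)

    split-join : ∀ s → split (join s) ≡ s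
    split-join (_ , i< , _ , j< , _ , k< , (v , refl , refl , refl) , (w , p , q , r))
      rewrite <-irrelevant (+≡⇒<suc (≡∸⇒+≡ i< p)) i<
            | <-irrelevant (+≡⇒<suc (≡∸⇒+≡ j< q)) j<
            | <-irrelevant (+≡⇒<suc (≡∸⇒+≡ k< r)) k<
      = cong (λ u → qDeg V v , i< , xDeg V v , j< , yDeg V v , k< , (v , refl , refl , refl) , u)
             (fibre-≡ {W} refl)

  splittings-↔ : Splittings ↔ Fibre (V ×ʷ W) N a b
  splittings-↔ = mk↔ₛ′ join split (λ _ → fibre-≡ {V ×ʷ W} refl) split-join

⊛-enumerates : ∀ {f g V W} → f Enumerates V → g Enumerates W → (f ⊛ g) Enumerates (V ×ʷ W)
⊛-enumerates {V = V} {W} ef eg N a b =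
  ↔-trans (∑<-↔ (suc N) _) (↔-trans
    (Σ<-cong λ i → ↔-trans (∑<-↔ (suc a) _) (Σ<-cong λ j → ↔-trans (∑<-↔ (suc b) _)
      (Σ<-cong λ k → ↔-trans *↔× (ef i j k ×-↔ eg (N ∸ i) (a ∸ j) (b ∸ k)))))
    (splittings-↔ V W N a b))

factorʷ : ℕ → Weighted
factorʷ n = point 0 1 0 ⊎ʷ point (2 * n + 1) 0 1

pochNumʷ : ℕ → Weighted
pochNumʷ zero    = point 0 0 0
pochNumʷ (suc n) = pochNumʷ n ×ʷ factorʷ n

pochDenInvʷ : ℕ → Weighted
pochDenInvʷ zero    = point 0 0 0
pochDenInvʷ (suc n) = pochDenInvʷ n ×ʷ multiplesOf (4 * suc n)

termʷ : ℕ → Weighted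
termʷ n = (pochNumʷ n ×ʷ point (n * n) 0 0) ×ʷ pochDenInvʷ n

pochNum-enumerates : ∀ n → pochNum n Enumerates pochNumʷ n
pochNum-enumerates zero    = mono-enumerates 0 0 0
pochNum-enumerates (suc n) = ⊛-enumerates (pochNum-enumerates n)
  (⊕-enumerates (mono-enumerates 0 1 0) (mono-enumerates (2 * n + 1) 0 1))

pochDenInv-enumerates : ∀ n → pochDenInv n Enumerates pochDenInvʷ n
pochDenInv-enumerates zero    = mono-enumerates 0 0 0
pochDenInv-enumerates (suc n) = ⊛-enumerates (pochDenInv-enumerates n) (geomInv4-enumerates n)

term-enumerates : ∀ n → term n Enumerates termʷ n
term-enumerates n = ⊛-enumerates
  (⊛-enumerates (pochNum-enumerates n) (mono-enumerates (n * n) 0 0)) (pochDenInv-enumerates n)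

-- A choice of the factor x, resp. y q^(2n+1), in (x + y q^(2n+1)) makes the
-- new smallest part odd, resp. even.
pattern xFactor = inj₁ tt
pattern yFactor = inj₂ tt

Choice : Set
Choice = ⊤ ⊎ ⊤

residue : Choice → ℕ
residue xFactor = 1
residue yFactor = 2

newPart : Choice → ℕ → ℕ
newPart c m = residue c + m * 4

shift : Choice → ℕ → ℕ
shift c m = newPart c m + residue c

LastPart : ℕ → Set
LastPart z = z % 4 ≡ 1 ⊎ z % 4 ≡ 2

residue-positive : ∀ c → 0 < residue c
residue-positive xFactor = s≤s z≤n
residue-positive yFactor = s≤s z≤n

residue-injective : ∀ {c c′} → residue c ≡ residue c′ → c ≡ c′
residue-injective {xFactor} {xFactor} _ = refl
residue-injective {yFactor} {yFactor} _ = refl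
residue-injective {xFactor} {yFactor} ()
residue-injective {yFactor} {xFactor} ()

newPart-residue : ∀ c m → newPart c m % 4 ≡ residue c
newPart-residue xFactor m = [m+kn]%n≡m%n 1 m 4
newPart-residue yFactor m = [m+kn]%n≡m%n 2 m 4

newPart-lastPart : ∀ c m → LastPart (newPart c m)
newPart-lastPart xFactor m = inj₁ (newPart-residue xFactor m)
newPart-lastPart yFactor m = inj₂ (newPart-residue yFactor m)

%4-split : ∀ z {r} → z % 4 ≡ r → z ≡ r + z / 4 * 4
%4-split z refl = m≡m%n+[m/n]*n z 4

lastPart⇒newPart : ∀ z → LastPart z → ∃₂ λ c m → newPart c m ≡ z
lastPart⇒newPart z (inj₁ r) = xFactor , z / 4 , sym (%4-split z r)
lastPart⇒newPart z (inj₂ r) = yFactor , z / 4 , sym (%4-split z r)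

newPart-injective : ∀ {c m c′ m′} → newPart c m ≡ newPart c′ m′ → c ≡ c′ × m ≡ m′
newPart-injective {c} {m} {c′} {m′} e
  with residue-injective (trans (sym (newPart-residue c m)) (trans (cong (_% 4) e) (newPart-residue c′ m′)))
... | refl = refl , *-cancelʳ-≡ m m′ 4 (+-cancelˡ-≡ (residue c) _ _ e)

isOdd-+-double : ∀ x k → isOdd (x + k * 2) ≡ isOdd x
isOdd-+-double x k = cong (_≡ᵇ 1) ([m+kn]%n≡m%n x k 2)

isOdd-newPart : ∀ c m → isOdd (newPart c m) ≡ isOdd (residue c)
isOdd-newPart c m =
  trans (cong (λ t → isOdd (residue c + t)) (sym (*-assoc m 2 2))) (isOdd-+-double (residue c) (m * 2))

isOdd-shift+ : ∀ c m x → isOdd (shift c m + x) ≡ isOdd x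
isOdd-shift+ c m x = trans (cong isOdd (shift-even (residue c) m x)) (isOdd-+-double x (residue c + m * 2))
  where
  shift-even : ∀ r m x → ((r + m * 4) + r) + x ≡ x + (r + m * 2) * 2
  shift-even = solve-∀

shift+∸newPart : ∀ c m x → (shift c m + x) ∸ newPart c m ≡ residue c + x
shift+∸newPart c m x =
  trans (cong (_∸ newPart c m) (+-assoc (newPart c m) (residue c) x)) (m+n∸m≡n (newPart c m) _)

gap-transport : ∀ {d d′ u u′ v v′} → d ≡ d′ → u ≡ u′ → v ≡ v′ →
                d % 4 ≡ requiredGap u v → d′ % 4 ≡ requiredGap u′ v′
gap-transport refl refl refl g = g

gap-residue : ∀ c c′ m′ →
              (residue c + newPart c′ m′) % 4 ≡ requiredGap (isOdd (residue c′)) (isOdd (residue c))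
gap-residue xFactor xFactor m′ = [m+kn]%n≡m%n 2 m′ 4
gap-residue xFactor yFactor m′ = [m+kn]%n≡m%n 3 m′ 4
gap-residue yFactor xFactor m′ = [m+kn]%n≡m%n 3 m′ 4
gap-residue yFactor yFactor m′ = [m+kn]%n≡m%n 4 m′ 4

gap-residue⁻¹ : ∀ c v {e} → 0 < e → e % 4 ≡ requiredGap v (isOdd (residue c)) →
                ∃₂ λ c′ m′ → e ≡ residue c + newPart c′ m′
gap-residue⁻¹ c v {e} e>0 g =
  let c′ , m′ , eq = table c v (e / 4) (subst (0 <_) e≡ e>0) in c′ , m′ , trans e≡ eq
  where
  e≡ : e ≡ requiredGap v (isOdd (residue c)) + e / 4 * 4
  e≡ = %4-split e g
  table : ∀ c v q → 0 < requiredGap v (isOdd (residue c)) + q * 4 →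
          ∃₂ λ c′ m′ → requiredGap v (isOdd (residue c)) + q * 4 ≡ residue c + newPart c′ m′
  table xFactor true  q       _ = xFactor , q , refl
  table xFactor false q       _ = yFactor , q , refl
  table yFactor true  q       _ = xFactor , q , refl
  table yFactor false zero    ()
  table yFactor false (suc q) _ = yFactor , q , refl

Link : ℕ → ℕ → Set
Link a b = b < a × (a ∸ b) % 4 ≡ requiredGap (isOdd a) (isOdd b)

p4-link : ∀ {a b l} → Link a b → P4 (b ∷ l) → P4 (a ∷ b ∷ l)
p4-link (b<a , gap) = p4-cons b<a gap

link-shift : ∀ c m {a b} → Link a b → Link (shift c m + a) (shift c m + b)
link-shift c m {a} {b} (b<a , gap) =
  +-monoʳ-< (shift c m) b<a ,
  gap-transport (sym ([m+n]∸[m+o]≡n∸o (shift c m) a b))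
                (sym (isOdd-shift+ c m a)) (sym (isOdd-shift+ c m b)) gap

link-unshift : ∀ c m {x y} → Link x (shift c m + y) → ∃ λ x₀ → x ≡ shift c m + x₀ × Link x₀ y
link-unshift c m {x} {y} (s+y<x , gap)
  with m≤n⇒∃[o]m+o≡n (≤-trans (m≤m+n (shift c m) y) (<⇒≤ s+y<x))
... | x₀ , refl =
  x₀ , refl , +-cancelˡ-< (shift c m) y x₀ s+y<x ,
  gap-transport ([m+n]∸[m+o]≡n∸o (shift c m) x₀ y) (isOdd-shift+ c m x₀) (isOdd-shift+ c m y) gap

link-last : ∀ c m {x} → LastPart x → Link (shift c m + x) (newPart c m)
link-last c m {x} r with lastPart⇒newPart x r
... | c′ , m′ , refl =
  ≤-trans (m<m+n (newPart c m) (residue-positive c)) (m≤m+n (shift c m) x) ,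
  gap-transport (sym (shift+∸newPart c m x))
                (sym (trans (isOdd-shift+ c m x) (isOdd-newPart c′ m′))) (sym (isOdd-newPart c m))
                (gap-residue c c′ m′)

link-unlast : ∀ c m {y} → Link y (newPart c m) → ∃₂ λ c′ m′ → y ≡ shift c m + newPart c′ m′
link-unlast c m {y} (np<y , gap) with m≤n⇒∃[o]m+o≡n (<⇒≤ np<y)
... | e , refl =
  let c′ , m′ , e≡ = gap-residue⁻¹ c (isOdd y) e>0
                       (gap-transport (m+n∸m≡n (newPart c m) e) refl (isOdd-newPart c m) gap)
  in c′ , m′ , trans (cong (newPart c m +_) e≡) (sym (+-assoc (newPart c m) (residue c) _))
  where
  e>0 : 0 < e
  e>0 = subst (0 <_) (m+n∸m≡n (newPart c m) e) (m<n⇒0<n∸m np<y)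

grow : Choice → ℕ → List ℕ → List ℕ
grow c m l = map (shift c m +_) l ∷ʳ newPart c m

grow-P4 : ∀ c m {l} → P4 l → P4 (grow c m l)
grow-P4 c m p4-nil                 = p4-last (newPart-lastPart c m)
grow-P4 c m (p4-last r)            = p4-link (link-last c m r) (p4-last (newPart-lastPart c m))
grow-P4 c m (p4-cons b<a gap rest) = p4-link (link-shift c m (b<a , gap)) (grow-P4 c m rest)

grow-P4⁻¹ : ∀ c m xs → P4 (xs ∷ʳ newPart c m) → ∃ λ ys → P4 ys × map (shift c m +_) ys ≡ xs
grow-P4⁻¹ c m []           _ = [] , p4-nil , refl
grow-P4⁻¹ c m (x ∷ [])     (p4-cons b<a gap _) with link-unlast c m (b<a , gap)
... | c′ , m′ , refl = newPart c′ m′ ∷ [] , p4-last (newPart-lastPart c′ m′) , refl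
grow-P4⁻¹ c m (x ∷ y ∷ xs) (p4-cons b<a gap rest) with grow-P4⁻¹ c m (y ∷ xs) rest
... | [] , _ , ()
... | y₀ ∷ ys , P , refl with link-unshift c m (b<a , gap)
... | x₀ , refl , link = x₀ ∷ y₀ ∷ ys , p4-link link P , refl

size-++ : ∀ xs ys → size (xs ++ ys) ≡ size xs + size ys
size-++ []       ys = refl
size-++ (x ∷ xs) ys = trans (cong (x +_) (size-++ xs ys)) (sym (+-assoc x (size xs) (size ys)))

oddParts-++ : ∀ xs ys → oddParts (xs ++ ys) ≡ oddParts xs + oddParts ys
oddParts-++ []       ys = refl
oddParts-++ (x ∷ xs) ys =
  trans (cong (_ +_) (oddParts-++ xs ys)) (sym (+-assoc (if isOdd x then 1 else 0) _ _))

evenParts-++ : ∀ xs ys → evenParts (xs ++ ys) ≡ evenParts xs + evenParts ys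
evenParts-++ []       ys = refl
evenParts-++ (x ∷ xs) ys =
  trans (cong (_ +_) (evenParts-++ xs ys)) (sym (+-assoc (if isOdd x then 0 else 1) _ _))

size-map-+ : ∀ s xs → size (map (s +_) xs) ≡ length xs * s + size xs
size-map-+ s []       = refl
size-map-+ s (x ∷ xs) = trans (cong ((s + x) +_) (size-map-+ s xs)) (regroup s x (length xs) (size xs))
  where
  regroup : ∀ s x l z → (s + x) + (l * s + z) ≡ (s + l * s) + (x + z)
  regroup = solve-∀

oddParts-map-shift : ∀ c m xs → oddParts (map (shift c m +_) xs) ≡ oddParts xs
oddParts-map-shift c m []       = refl
oddParts-map-shift c m (x ∷ xs) =
  cong₂ _+_ (cong (λ b → if b then 1 else 0) (isOdd-shift+ c m x)) (oddParts-map-shift c m xs)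

evenParts-map-shift : ∀ c m xs → evenParts (map (shift c m +_) xs) ≡ evenParts xs
evenParts-map-shift c m []       = refl
evenParts-map-shift c m (x ∷ xs) =
  cong₂ _+_ (cong (λ b → if b then 0 else 1) (isOdd-shift+ c m x)) (evenParts-map-shift c m xs)

length-parts : ∀ l → length l ≡ oddParts l + evenParts l
length-parts []      = refl
length-parts (x ∷ l) with isOdd x
... | true  = cong suc (length-parts l)
... | false = trans (cong suc (length-parts l)) (sym (+-suc (oddParts l) (evenParts l)))

length-grow : ∀ c m l → length (grow c m l) ≡ suc (length l)
length-grow c m l = trans (length-++ (map (shift c m +_) l))
                          (trans (cong (_+ 1) (length-map (shift c m +_) l)) (+-comm (length l) 1))

grow-injective : ∀ c m l c′ m′ l′ → grow c m l ≡ grow c′ m′ l′ → c ≡ c′ × m ≡ m′ × l ≡ l′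
grow-injective c m l c′ m′ l′ e with ∷ʳ-injective (map _ l) (map _ l′) e
... | e₁ , e₂ with newPart-injective {c} {m} {c′} {m′} e₂
... | refl , refl = refl , refl , map-injective (+-cancelˡ-≡ (shift c m) _ _) e₁

P4-irrelevant : ∀ {l} → Irrelevant (P4 l)
P4-irrelevant p4-nil             p4-nil             = refl
P4-irrelevant (p4-last (inj₁ r)) (p4-last (inj₁ r′)) = cong (p4-last ∘ inj₁) (≡-irrelevant r r′)
P4-irrelevant (p4-last (inj₂ r)) (p4-last (inj₂ r′)) = cong (p4-last ∘ inj₂) (≡-irrelevant r r′)
P4-irrelevant (p4-last (inj₁ r)) (p4-last (inj₂ r′)) with () ← trans (sym r) r′
P4-irrelevant (p4-last (inj₂ r)) (p4-last (inj₁ r′)) with () ← trans (sym r) r′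
P4-irrelevant (p4-cons b<a gap rest) (p4-cons b<a′ gap′ rest′)
  with <-irrelevant b<a b<a′ | ≡-irrelevant gap gap′ | P4-irrelevant rest rest′
... | refl | refl | refl = refl

P4-lastPart : ∀ xs {z} → P4 (xs ∷ʳ z) → LastPart z
P4-lastPart []           (p4-last r)        = r
P4-lastPart (_ ∷ [])     (p4-cons _ _ rest) = P4-lastPart [] rest
P4-lastPart (_ ∷ y ∷ xs) (p4-cons _ _ rest) = P4-lastPart (y ∷ xs) rest

P4-head-positive : ∀ {x l} → P4 (x ∷ l) → 0 < x
P4-head-positive {zero}  (p4-last (inj₁ ()))
P4-head-positive {zero}  (p4-last (inj₂ ()))
P4-head-positive {suc _} (p4-last _)       = s≤s z≤n
P4-head-positive         (p4-cons b<a _ _) = <-≤-trans (s≤s z≤n) b<a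

length≤size : ∀ {l} → P4 l → length l ≤ size l
length≤size p4-nil                           = z≤n
length≤size {x ∷ []}    P                    = subst (1 ≤_) (sym (+-identityʳ x)) (P4-head-positive P)
length≤size {x ∷ _ ∷ _} P@(p4-cons _ _ rest) = +-mono-≤ (P4-head-positive P) (length≤size rest)

partition : ∀ n → Carrier (pochNumʷ n) → Carrier (pochDenInvʷ n) → List ℕ
partition zero    _       _       = []
partition (suc n) (p , c) (d , m) = grow c m (partition n p d)

partition-P4 : ∀ n p d → P4 (partition n p d)
partition-P4 zero    _       _       = p4-nil
partition-P4 (suc n) (p , c) (d , m) = grow-P4 c m (partition-P4 n p d)

partition-length : ∀ n p d → length (partition n p d) ≡ n
partition-length zero    _       _       = refl
partition-length (suc n) (p , c) (d , m) =
  trans (length-grow c m (partition n p d)) (cong suc (partition-length n p d))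

partition-size : ∀ n p d → size (partition n p d) ≡ qDeg (termʷ n) ((p , tt) , d)
partition-size zero    _       _       = refl
partition-size (suc n) (p , c) (d , m) = begin
  size (grow c m L)
    ≡⟨ size-++ (map (shift c m +_) L) [ newPart c m ] ⟩
  size (map (shift c m +_) L) + (newPart c m + 0)
    ≡⟨ cong (_+ (newPart c m + 0)) (size-map-+ (shift c m) L) ⟩
  (length L * shift c m + size L) + (newPart c m + 0)
    ≡⟨ cong₂ (λ ℓ s → (ℓ * shift c m + s) + (newPart c m + 0))
             (partition-length n p d) (partition-size n p d) ⟩
  (n * shift c m + qDeg (termʷ n) ((p , tt) , d)) + (newPart c m + 0)
    ≡⟨ grow-qDeg c ⟩
  qDeg (termʷ (suc n)) (((p , c) , tt) , (d , m)) ∎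
  where
  open ≡-Reasoning
  L = partition n p d
  step-x : ∀ n m P D → (n * ((1 + m * 4) + 1) + ((P + n * n) + D)) + ((1 + m * 4) + 0)
                       ≡ ((P + 0) + suc n * suc n) + (D + m * (4 * suc n))
  step-x = solve-∀
  step-y : ∀ n m P D → (n * ((2 + m * 4) + 2) + ((P + n * n) + D)) + ((2 + m * 4) + 0)
                       ≡ ((P + (2 * n + 1)) + suc n * suc n) + (D + m * (4 * suc n))
  step-y = solve-∀
  grow-qDeg : ∀ c → (n * shift c m + qDeg (termʷ n) ((p , tt) , d)) + (newPart c m + 0)
                    ≡ qDeg (termʷ (suc n)) (((p , c) , tt) , (d , m))
  grow-qDeg xFactor = step-x n m (qDeg (pochNumʷ n) p) (qDeg (pochDenInvʷ n) d)
  grow-qDeg yFactor = step-y n m (qDeg (pochNumʷ n) p) (qDeg (pochDenInvʷ n) d)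

regroup-counts : ∀ a b k → ((a + 0) + b) + (k + 0) ≡ ((a + k) + 0) + (b + 0)
regroup-counts = solve-∀

partition-oddParts : ∀ n p d → oddParts (partition n p d) ≡ xDeg (termʷ n) ((p , tt) , d)
partition-oddParts zero    _       _       = refl
partition-oddParts (suc n) (p , c) (d , m) = begin
  oddParts (grow c m L)
    ≡⟨ oddParts-++ (map (shift c m +_) L) [ newPart c m ] ⟩
  oddParts (map (shift c m +_) L) + oddParts [ newPart c m ]
    ≡⟨ cong₂ _+_ (trans (oddParts-map-shift c m L) (partition-oddParts n p d)) (oddParts-newPart c) ⟩
  xDeg (termʷ n) ((p , tt) , d) + (xDeg (factorʷ n) c + 0)
    ≡⟨ regroup-counts (xDeg (pochNumʷ n) p) (xDeg (pochDenInvʷ n) d) (xDeg (factorʷ n) c) ⟩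
  xDeg (termʷ (suc n)) (((p , c) , tt) , (d , m)) ∎
  where
  open ≡-Reasoning
  L = partition n p d
  oddParts-newPart : ∀ c → oddParts [ newPart c m ] ≡ xDeg (factorʷ n) c + 0
  oddParts-newPart xFactor = cong (λ b → (if b then 1 else 0) + 0) (isOdd-newPart xFactor m)
  oddParts-newPart yFactor = cong (λ b → (if b then 1 else 0) + 0) (isOdd-newPart yFactor m)

partition-evenParts : ∀ n p d → evenParts (partition n p d) ≡ yDeg (termʷ n) ((p , tt) , d)
partition-evenParts zero    _       _       = refl
partition-evenParts (suc n) (p , c) (d , m) = begin
  evenParts (grow c m L)
    ≡⟨ evenParts-++ (map (shift c m +_) L) [ newPart c m ] ⟩
  evenParts (map (shift c m +_) L) + evenParts [ newPart c m ]
    ≡⟨ cong₂ _+_ (trans (evenParts-map-shift c m L) (partition-evenParts n p d)) (evenParts-newPart c) ⟩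
  yDeg (termʷ n) ((p , tt) , d) + (yDeg (factorʷ n) c + 0)
    ≡⟨ regroup-counts (yDeg (pochNumʷ n) p) (yDeg (pochDenInvʷ n) d) (yDeg (factorʷ n) c) ⟩
  yDeg (termʷ (suc n)) (((p , c) , tt) , (d , m)) ∎
  where
  open ≡-Reasoning
  L = partition n p d
  evenParts-newPart : ∀ c → evenParts [ newPart c m ] ≡ yDeg (factorʷ n) c + 0
  evenParts-newPart xFactor = cong (λ b → (if b then 0 else 1) + 0) (isOdd-newPart xFactor m)
  evenParts-newPart yFactor = cong (λ b → (if b then 0 else 1) + 0) (isOdd-newPart yFactor m)

partition-injective : ∀ n {p d p′ d′} → partition n p d ≡ partition n p′ d′ → (p , d) ≡ (p′ , d′)
partition-injective zero    _ = refl
partition-injective (suc n) {p , c} {d , m} {p′ , c′} {d′ , m′} e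
  with grow-injective c m (partition n p d) c′ m′ (partition n p′ d′) e
... | refl , refl , e′ with partition-injective n e′
... | refl = refl

partition-surjective : ∀ n {l} → P4 l → length l ≡ n → ∃₂ λ p d → partition n p d ≡ l
partition-surjective zero    {[]}        _ _   = tt , tt , refl
partition-surjective (suc n) {l} P len with initLast l
partition-surjective (suc n) _ () | []
... | xs ∷ʳ′ z with lastPart⇒newPart z (P4-lastPart xs P)
... | c , m , refl with grow-P4⁻¹ c m xs P
... | ys , Pys , refl with partition-surjective n Pys (suc-injective (trans (sym (length-grow c m ys)) len))
... | p , d , refl = (p , c) , (d , m) , refl

P4ofLength : ℕ → Weighted
P4ofLength n = weighted (Σ (List ℕ) λ l → P4 l × length l ≡ n)
                        (size ∘ proj₁) (oddParts ∘ proj₁) (evenParts ∘ proj₁)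

toP4 : ∀ n → Carrier (termʷ n) → Carrier (P4ofLength n)
toP4 n ((p , _) , d) = partition n p d , partition-P4 n p d , partition-length n p d

toP4-bijective : ∀ n → Bijective _≡_ _≡_ (toP4 n)
toP4-bijective n = injective , strictlySurjective⇒surjective surjective
  where
  injective : ∀ {u v} → toP4 n u ≡ toP4 n v → u ≡ v
  injective {(_ , _) , _} {(_ , _) , _} e with partition-injective n (cong proj₁ e)
  ... | refl = refl
  surjective : ∀ w → ∃ λ u → toP4 n u ≡ w
  surjective (_ , P , len) with partition-surjective n P len
  ... | p , d , refl = ((p , tt) , d) ,
    cong₂ (λ P len → partition n p d , P , len) (P4-irrelevant _ _) (≡-irrelevant _ _)

term-↔ : ∀ n N a b → Fin (term n N a b) ↔ Fibre (P4ofLength n) N a b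
term-↔ n N a b = ↔-trans (term-enumerates n N a b)
  (fibre-↔ (⤖⇒↔ (mk⤖ (toP4-bijective n)))
    (λ ((p , _) , d) → partition-size n p d)
    (λ ((p , _) , d) → partition-oddParts n p d)
    (λ ((p , _) , d) → partition-evenParts n p d))

↔-empty⇒0 : ∀ {k} {A : Set} → Fin k ↔ A → ¬ A → k ≡ 0
↔-empty⇒0 {zero}  _ _  = refl
↔-empty⇒0 {suc _} e ¬A = ⊥-elim (¬A (to e zero))

term-vanishes-off : ∀ {n N a b} → n ≢ a + b → term n N a b ≡ 0
term-vanishes-off {n} {N} {a} {b} n≢a+b = ↔-empty⇒0 (term-↔ n N a b)
  λ ((l , _ , len) , _ , odd , even) → n≢a+b (trans (sym len) (trans (length-parts l) (cong₂ _+_ odd even)))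

term-vanishes-above : ∀ {n N a b} → N < n → term n N a b ≡ 0
term-vanishes-above {n} {N} {a} {b} N<n = ↔-empty⇒0 (term-↔ n N a b)
  λ ((_ , P , len) , size≡N , _) → <-irrefl refl (<-≤-trans N<n (subst₂ _≤_ len size≡N (length≤size P)))

P4ofLength-↔-P4with : ∀ {P : ℕ → Set} → (∀ {ℓ} → Irrelevant (P ℓ)) →
                      ∀ {N a b} → P (a + b) → Fibre (P4ofLength (a + b)) N a b ↔ P4with P N a b
P4ofLength-↔-P4with {P} P-irrelevant {N} {a} {b} P[a+b] = mk↔ₛ′ forget remember
  (λ (l , P4l , Pl , w) → cong (λ Pl → l , P4l , Pl , w) (P-irrelevant _ _))
  (λ ((l , P4l , _) , w) → cong (λ len → (l , P4l , len) , w) (≡-irrelevant _ _))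
  where
  forget : Fibre (P4ofLength (a + b)) N a b → P4with P N a b
  forget ((l , P4l , len) , w) = l , P4l , subst P (sym len) P[a+b] , w
  remember : P4with P N a b → Fibre (P4ofLength (a + b)) N a b
  remember (l , P4l , _ , w@(_ , odd , even)) = (l , P4l , trans (length-parts l) (cong₂ _+_ odd even)) , w

P4with-empty : ∀ {P : ℕ → Set} {N a b} → ¬ P (a + b) → ¬ P4with P N a b
P4with-empty {P} ¬P[a+b] (l , _ , Pl , _ , odd , even) =
  ¬P[a+b] (subst P (trans (length-parts l) (cong₂ _+_ odd even)) Pl)

-- ∑series (term ∘ index) runs, each once, over the summands whose lengths
-- satisfy P; inflationarity makes the truncation of ∑series at q^N harmless.
record Selection (P : ℕ → Set) : Set where
  field
    index        : ℕ → ℕ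
    inflationary : ∀ k → k ≤ index k
    injective    : ∀ {j k} → index j ≡ index k → j ≡ k
    irrelevant   : ∀ {ℓ} → Irrelevant (P ℓ)
    decide       : Decidable P
    image        : ∀ ℓ → P ℓ ⇔ ∃ λ k → index k ≡ ℓ

module _ {P : ℕ → Set} (S : Selection P) where
  open Selection S

  ∑series-single : ∀ {N a b k} → index k ≡ a + b →
                   ∑series (λ j → term (index j)) N a b ≡ term (a + b) N a b
  ∑series-single {N} {a} {b} {k} k↦ = trans
    (∑<-single (suc N) k (λ j → term (index j) N a b)
      (λ j j≢k → term-vanishes-off {index j} {N} {a} {b} (λ j↦ → j≢k (injective (trans j↦ (sym k↦)))))
      (λ N<k → term-vanishes-above {index k} {N} {a} {b} (<-≤-trans N<k (inflationary k))))
    (cong (λ n → term n N a b) k↦)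

  ∑series-vanishes : ∀ {N a b} → (∀ k → index k ≢ a + b) → ∑series (λ j → term (index j)) N a b ≡ 0
  ∑series-vanishes {N} {a} {b} off =
    ∑<-vanishes (suc N) _ (λ k _ → term-vanishes-off {index k} {N} {a} {b} (off k))

  coefficient-↔ : ∀ N a b → Fin (∑series (λ j → term (index j)) N a b) ↔ P4with P N a b
  coefficient-↔ N a b with decide (a + b)
  ... | yes P[a+b] =
    let k , k↦ = Equivalence.to (image (a + b)) P[a+b] in
    subst (λ t → Fin t ↔ P4with P N a b) (sym (∑series-single {N} {a} {b} k↦))
          (↔-trans (term-↔ (a + b) N a b) (P4ofLength-↔-P4with {P} irrelevant P[a+b]))
  ... | no ¬P[a+b] =
    empty-↔ (∑series-vanishes {N} {a} {b} λ k k↦ → ¬P[a+b] (subst P k↦ (indexed k)))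
            (P4with-empty {P} ¬P[a+b])
    where
    indexed : ∀ k → P (index k)
    indexed k = Equivalence.from (image (index k)) (k , refl)

evenLengths : Selection (λ ℓ → ℓ % 2 ≡ 0)
evenLengths = record
  { index        = λ k → 2 * k
  ; inflationary = λ k → m≤m+n k (k + 0)
  ; injective    = *-cancelˡ-≡ _ _ 2
  ; irrelevant   = ≡-irrelevant
  ; decide       = λ ℓ → ℓ % 2 ≟ 0
  ; image        = λ ℓ → mk⇔ (λ e → ℓ / 2 , m*[n/m]≡n (m%n≡0⇒n∣m ℓ 2 e))
                             (λ { (k , refl) → trans (cong (_% 2) (*-comm 2 k)) (m*n%n≡0 k 2) })
  }

oddLengths : Selection (λ ℓ → ℓ % 2 ≡ 1)
oddLengths = record
  { index        = λ k → 2 * k + 1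
  ; inflationary = λ k → ≤-trans (m≤m+n k (k + 0)) (m≤m+n (2 * k) 1)
  ; injective    = λ {j} {k} e → *-cancelˡ-≡ j k 2 (+-cancelʳ-≡ 1 (2 * j) (2 * k) e)
  ; irrelevant   = ≡-irrelevant
  ; decide       = λ ℓ → ℓ % 2 ≟ 1
  ; image        = λ ℓ → mk⇔ (λ e → ℓ / 2 , odd-split ℓ e) (λ { (k , refl) → odd-index k })
  }
  where
  2k+1≡1+k*2 : ∀ k → 2 * k + 1 ≡ 1 + k * 2
  2k+1≡1+k*2 = solve-∀
  odd-index : ∀ k → (2 * k + 1) % 2 ≡ 1
  odd-index k = trans (cong (_% 2) (2k+1≡1+k*2 k)) ([m+kn]%n≡m%n 1 k 2)
  odd-split : ∀ ℓ → ℓ % 2 ≡ 1 → 2 * (ℓ / 2) + 1 ≡ ℓ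
  odd-split ℓ e = begin
    2 * (ℓ / 2) + 1      ≡⟨ 2k+1≡1+k*2 (ℓ / 2) ⟩
    1 + ℓ / 2 * 2        ≡⟨ cong (_+ ℓ / 2 * 2) (sym e) ⟩
    ℓ % 2 + ℓ / 2 * 2    ≡⟨ sym (m≡m%n+[m/n]*n ℓ 2) ⟩
    ℓ                    ∎
    where open ≡-Reasoning

allLengths : Selection (λ _ → ⊤)
allLengths = record
  { index        = λ k → k
  ; inflationary = λ _ → ≤-refl
  ; injective    = λ e → e
  ; irrelevant   = λ _ _ → refl
  ; decide       = λ _ → yes tt
  ; image        = λ ℓ → mk⇔ (λ _ → ℓ , refl) (λ _ → tt)
  }

theorem3p4 : ((N a b : ℕ) → Fin (rhsEven N a b) ↔ P4with (λ ℓ → ℓ % 2 ≡ 0) N a b)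
           × ((N a b : ℕ) → Fin (rhsOdd N a b) ↔ P4with (λ ℓ → ℓ % 2 ≡ 1) N a b)
           × ((N a b : ℕ) → Fin (rhsAll N a b) ↔ P4with (λ _ → ⊤) N a b)
theorem3p4 = coefficient-↔ evenLengths , coefficient-↔ oddLengths , coefficient-↔ allLengths
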